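{- Let $\beta \in S_n$, let $\beta_j$ be an $m$-cycle in the disjoint cycle decomposition of $\beta$, let $\alpha \in S_n$, and let $k \geq 1$. Then $\alpha$ $(k,\beta)$-commutes with $\beta_j$ if and only if $\alpha\beta_j\alpha^{ -1} = (P_1 \dots P_k)$ for blocks $P_1,\dots,P_k$ satisfying: (1) if $k=1$, then $P_1$ is a proper block in a cycle of $\beta$; (2) if $k>1$, then $P_1,\dots,P_k$ are $k$ pairwise disjoint blocks, from one or more cycles of $\beta$, such that for every $i \in [k]$ the string $P_iP_{i+1 \bmod k}$ is not a block in any cycle of $\beta$.
   Context: $S_n$ is the symmetric group on $[n]=\{1,\dots,n\}$; products are composed right to left ($\alpha\beta$ means first $\beta$, then $\alpha$). Cycles of a permutation include its fixed points as $1$-cycles. The convention $m \bmod m = m$ is used. For a cycle $(a_1 a_2 \dots a_m)$ of a permutation, a block is a string $a_ia_{i+1}\dots a_{i+l-1}$ of $l$ consecutive entries of the cycle, $1 \le l \le m$, indices taken modulo $m$; its length is $l$; it is proper if $l<m$ and improper if $l=m$. Two blocks are disjoint if they share no point; the product of disjoint blocks is concatenation of strings. For a cycle $\sigma$ and a string $Q$ (possibly a concatenation of blocks), $\sigma=(Q)$ means that $Q$ is one of the cyclic rotations of the cycle notation of $\sigma$. A point $a$ is a bad commuting point of $\alpha,\beta$ if $\alpha\beta(a)\neq\beta\alpha(a)$. The permutation $\alpha$ $(k,\beta)$-commutes with a cycle $\beta_j$ of $\beta$ if exactly $k$ points of $\beta_j$ are bad commuting points of $\alpha$ and $\beta$.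 -}

module Defs where

open import Data.Nat using (ℕ; zero; suc; _≤_; _<_; NonZero)
open import Data.Nat.DivMod using (_%_; m%n<n)
open import Data.Fin using (Fin; toℕ; fromℕ<)
open import Data.Fin.Properties using (_≟_)
open import Data.Fin.Permutation using (Permutation′; _⟨$⟩ʳ_; _⟨$⟩ˡ_)
open import Data.List using (List; []; _∷_; _++_; map; upTo; drop; take; length; filter; concat; tabulate)
open import Data.List.Membership.Propositional using (_∈_)
open import Data.Product using (Σ; ∃; _×_; _,_)
open import Relation.Nullary using (¬_; ¬?)
open import Relation.Binary.PropositionalEquality using (_≡_; _≢_)

iter : ∀ {n} → (Fin n → Fin n) → ℕ → Fin n → Fin n
iter f zero x = x
iter f (suc t) x = f (iter f t x)

orbitString : ∀ {n} → (Fin n → Fin n) → Fin n → ℕ → List (Fin n)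
orbitString f x l = map (λ t → iter f t x) (upTo l)

IsCycleLength : ∀ {n} → Permutation′ n → Fin n → ℕ → Set
IsCycleLength β a m =
  (1 ≤ m) × (iter (β ⟨$⟩ʳ_) m a ≡ a) × (∀ t → 1 ≤ t → t < m → iter (β ⟨$⟩ʳ_) t a ≢ a)

cycleString : ∀ {n} → Permutation′ n → Fin n → ℕ → List (Fin n)
cycleString β a m = orbitString (β ⟨$⟩ʳ_) a m

IsBlock : ∀ {n} → Permutation′ n → List (Fin n) → Set
IsBlock β s = Σ (Fin _) λ c → Σ ℕ λ m → Σ ℕ λ l →
  IsCycleLength β c m × (1 ≤ l) × (l ≤ m) × (s ≡ orbitString (β ⟨$⟩ʳ_) c l)

IsProperBlock : ∀ {n} → Permutation′ n → List (Fin n) → Set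
IsProperBlock β s = Σ (Fin _) λ c → Σ ℕ λ m → Σ ℕ λ l →
  IsCycleLength β c m × (1 ≤ l) × (l < m) × (s ≡ orbitString (β ⟨$⟩ʳ_) c l)

IsRotationOf : ∀ {n} → List (Fin n) → List (Fin n) → Set
IsRotationOf Q L = ∃ λ r → (r ≤ length L) × (Q ≡ drop r L ++ take r L)

badPoints : ∀ {n} → Permutation′ n → Permutation′ n → Fin n → ℕ → List (Fin n)
badPoints α β a m =
  filter (λ x → ¬? ((α ⟨$⟩ʳ (β ⟨$⟩ʳ x)) ≟ (β ⟨$⟩ʳ (α ⟨$⟩ʳ x)))) (cycleString β a m)

KBetaCommutes : ∀ {n} → ℕ → Permutation′ n → Permutation′ n → Fin n → ℕ → Set
KBetaCommutes k α β a m = length (badPoints α β a m) ≡ k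

conj : ∀ {n} → Permutation′ n → Permutation′ n → Fin n → Fin n
conj α β x = α ⟨$⟩ʳ (β ⟨$⟩ʳ (α ⟨$⟩ˡ x))

-- cycle notation of α β_j α⁻¹, where β_j is the m-cycle of β through a:
-- the cycle of α β α⁻¹ through α(a), written from α(a)
conjCycleString : ∀ {n} → Permutation′ n → Permutation′ n → Fin n → ℕ → List (Fin n)
conjCycleString α β a m = orbitString (conj α β) (α ⟨$⟩ʳ a) m

-- cyclic successor i ↦ i+1 mod k on Fin k (with m mod m = m, i.e. k ↦ 1 in 1-based terms)
next : ∀ {k} → Fin k → Fin k
next {suc k} i = fromℕ< (m%n<n (suc (toℕ i)) (suc k))

concatBlocks : ∀ {n k} → (Fin k → List (Fin n)) → List (Fin n)
concatBlocks P = concat (tabulate P)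

PairwiseDisjoint : ∀ {n k} → (Fin k → List (Fin n)) → Set
PairwiseDisjoint {n} {k} P = ∀ (i j : Fin k) → i ≢ j → ∀ (x : Fin n) → x ∈ P i → ¬ (x ∈ P j)

BlockConditions : ∀ {n} → Permutation′ n → (k : ℕ) → (Fin k → List (Fin n)) → Set
BlockConditions β k P =
  (k ≡ 1 → ∀ i → IsProperBlock β (P i)) ×
  (1 < k → (∀ i → IsBlock β (P i)) × PairwiseDisjoint P × (∀ i → ¬ IsBlock β (P i ++ P (next i))))

-- Call an adjacent pair x y of a string a break if y ≠ β x.  A string without breaks (a
-- chain) is a segment of a β-orbit, and a chain of distinct points is a block.  The string
-- X = α (cycle of β through a) is the cycle notation of α β_j α⁻¹, and its adjacent pair
-- α x, α (β x) is a break exactly when x is a bad commuting point; so k is the number of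
-- breaks of X read cyclically, which is invariant under rotation.  Cutting a suitable
-- rotation of X at its k breaks gives chains P₁ … P_k with a break at every junction
-- P_i P_{i+1 mod k}.  For distinct points this is what conditions (1) and (2) say: the
-- junction P_i P_{i+1} is a break iff P_i P_{i+1} is not a block, and for k = 1 the junction
-- of P₁ with itself is a break iff P₁ is proper.

module Submission where

open import Defs
open import Data.Nat using (ℕ; zero; suc; _+_; _∸_; _≤_; _<_; z≤n; s≤s; _≤?_)
open import Data.Nat.Properties as ℕ using (anyUpTo?)
open import Data.Nat.Induction using (<-rec)
open import Data.Nat.ListAction using (sum)
open import Data.Nat.DivMod using (_%_; m<n⇒m%n≡m; n%n≡0)
open import Data.Fin using (Fin; zero; suc; toℕ; fromℕ; inject₁)
open import Data.Fin.Properties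
  using (_≟_; toℕ-injective; toℕ-fromℕ<; toℕ-inject₁; toℕ<n; toℕ-fromℕ; pigeonhole)
open import Data.Fin.Relation.Unary.Top using (view; ‵fromℕ; ‵inject₁)
open import Data.Fin.Permutation using (Permutation′; _⟨$⟩ʳ_; inverseˡ)
open import Data.List using (List; []; _∷_; _++_; [_]; map; upTo; applyUpTo; take; drop; length; filter)
open import Data.List.Properties as List using (++-assoc; ++-identityʳ; map-upTo; map-cong; take++drop≡id)
open import Data.List.Membership.Propositional using (_∈_)
open import Data.List.Relation.Unary.Any using (here; there)
open import Data.List.Relation.Unary.Unique.Propositional using (Unique; []; _∷_)
import Data.List.Relation.Unary.Unique.Propositional.Properties as Unique
import Data.List.Relation.Unary.All as All
import Data.List.Relation.Unary.All.Properties as All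
import Data.List.Relation.Binary.Permutation.Setoid.Properties as PermutationProperties
open import Data.List.Relation.Binary.Disjoint.Propositional using (Disjoint)
open import Data.List.Membership.Propositional.Properties using (∈-concat⁺′; ∈-tabulate⁺)
open import Data.Product using (Σ; ∃; _×_; _,_; proj₁; proj₂)
open import Data.Sum using (_⊎_; inj₁; inj₂)
open import Data.Empty using (⊥-elim)
open import Function.Base using (_∘_)
open import Function.Bundles using (_⇔_; mk⇔; Injection)
open import Function.Properties.Inverse using (↔⇒↣)
open import Relation.Nullary using (¬_; ¬?; Dec; yes; no)
open import Relation.Nullary.Decidable using (_×-dec_)
open import Relation.Binary.PropositionalEquality
  using (_≡_; _≢_; refl; sym; trans; cong; cong₂; subst; setoid; module ≡-Reasoning)

mismatch : ∀ {n} → Fin n → Fin n → ℕ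
mismatch x y with x ≟ y
... | yes _ = 0
... | no  _ = 1

module _ {n : ℕ} {x y : Fin n} where

  mismatch-≡ : x ≡ y → mismatch x y ≡ 0
  mismatch-≡ x≡y with x ≟ y
  ... | yes _   = refl
  ... | no  x≢y = ⊥-elim (x≢y x≡y)

  mismatch-≢ : x ≢ y → mismatch x y ≡ 1
  mismatch-≢ x≢y with x ≟ y
  ... | yes x≡y = ⊥-elim (x≢y x≡y)
  ... | no  _   = refl

  mismatch≡0⇒≡ : mismatch x y ≡ 0 → x ≡ y
  mismatch≡0⇒≡ _ with x ≟ y
  mismatch≡0⇒≡ _  | yes x≡y = x≡y
  mismatch≡0⇒≡ () | no  _

  mismatch≡0⊎1 : mismatch x y ≡ 0 ⊎ mismatch x y ≡ 1
  mismatch≡0⊎1 with x ≟ y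
  ... | yes _ = inj₁ refl
  ... | no  _ = inj₂ refl

next-inject₁ : ∀ {r} (j : Fin r) → next (inject₁ j) ≡ suc j
next-inject₁ {r} j = toℕ-injective (begin
  toℕ (next (inject₁ j))        ≡⟨ toℕ-fromℕ< _ ⟩
  suc (toℕ (inject₁ j)) % suc r ≡⟨ cong (λ t → suc t % suc r) (toℕ-inject₁ j) ⟩
  suc (toℕ j) % suc r           ≡⟨ m<n⇒m%n≡m (s≤s (toℕ<n j)) ⟩
  suc (toℕ j)                   ∎)
  where open ≡-Reasoning

next-fromℕ : ∀ r → next (fromℕ r) ≡ zero
next-fromℕ r = toℕ-injective (begin
  toℕ (next (fromℕ r))        ≡⟨ toℕ-fromℕ< _ ⟩
  suc (toℕ (fromℕ r)) % suc r ≡⟨ cong (λ t → suc t % suc r) (toℕ-fromℕ r) ⟩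
  suc r % suc r               ≡⟨ n%n≡0 (suc r) ⟩
  0                           ∎)
  where open ≡-Reasoning

next-elim : ∀ {r} (R : Fin (suc r) → Fin (suc r) → Set) →
  (∀ j → R (inject₁ j) (suc j)) → R (fromℕ r) zero → ∀ i → R i (next i)
next-elim R step last i with view i
... | ‵fromℕ     = subst (R _) (sym (next-fromℕ _)) last
... | ‵inject₁ j = subst (R _) (sym (next-inject₁ j)) (step j)

≢-next : ∀ {r} (i : Fin (suc (suc r))) → i ≢ next i
≢-next = next-elim _≢_ (λ j j≡ → ℕ.1+n≢n (sym (trans (sym (toℕ-inject₁ j)) (cong toℕ j≡)))) (λ ())

LeastPositive : (ℕ → Set) → ℕ → Set
LeastPositive P q = 1 ≤ q × P q × (∀ t → 1 ≤ t → t < q → ¬ P t)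

leastPositive-exists : ∀ {P : ℕ → Set} → (∀ t → Dec (P t)) →
  ∀ p → 1 ≤ p → P p → ∃ (LeastPositive P)
leastPositive-exists {P} P? = <-rec (λ p → 1 ≤ p → P p → ∃ (LeastPositive P)) search
  where
  search : ∀ p → (∀ {t} → t < p → 1 ≤ t → P t → ∃ (LeastPositive P)) →
    1 ≤ p → P p → ∃ (LeastPositive P)
  search p below 1≤p Pp with anyUpTo? (λ t → 1 ≤? t ×-dec P? t) p
  ... | yes (t , t<p , 1≤t , Pt) = below t<p 1≤t Pt
  ... | no  none                 = p , 1≤p , Pp , λ t 1≤t t<p Pt → none (t , t<p , 1≤t , Pt)

length-filter-≢ : ∀ {n} {A : Set} (g h : A → Fin n) xs →
  length (filter (λ x → ¬? (g x ≟ h x)) xs) ≡ sum (map (λ x → mismatch (g x) (h x)) xs)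
length-filter-≢ g h [] = refl
length-filter-≢ g h (x ∷ xs) with g x ≟ h x
... | yes _ = length-filter-≢ g h xs
... | no  _ = cong suc (length-filter-≢ g h xs)

module _ {n : ℕ} where
  open PermutationProperties (setoid (Fin n)) using (Unique-resp-↭; ++-comm)

  Unique-rotate : ∀ s (L : List (Fin n)) → Unique L → Unique (drop s L ++ take s L)
  Unique-rotate s L u = Unique-resp-↭ (++-comm (take s L) (drop s L)) (subst Unique (sym (take++drop≡id s L)) u)

  Unique-++⁻ˡ : ∀ xs {ys : List (Fin n)} → Unique (xs ++ ys) → Unique xs
  Unique-++⁻ˡ []       _         = []
  Unique-++⁻ˡ (x ∷ xs) (x∉ ∷ u) = All.++⁻ˡ xs x∉ ∷ Unique-++⁻ˡ xs u

  Unique-++⁻ʳ : ∀ xs {ys : List (Fin n)} → Unique (xs ++ ys) → Unique ys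
  Unique-++⁻ʳ []       u       = u
  Unique-++⁻ʳ (x ∷ xs) (_ ∷ u) = Unique-++⁻ʳ xs u

  Unique-++⇒Disjoint : ∀ xs {ys : List (Fin n)} → Unique (xs ++ ys) → Disjoint xs ys
  Unique-++⇒Disjoint (x ∷ xs) (x∉ ∷ _) (here refl , v∈ys)  = All.lookup (All.++⁻ʳ xs x∉) v∈ys refl
  Unique-++⇒Disjoint (x ∷ xs) (_ ∷ u)  (there v∈xs , v∈ys) = Unique-++⇒Disjoint xs u (v∈xs , v∈ys)

  Unique-concatBlocks⁻ : ∀ {k} (Q : Fin k → List (Fin n)) → Unique (concatBlocks Q) → ∀ i → Unique (Q i)
  Unique-concatBlocks⁻ Q u zero    = Unique-++⁻ˡ (Q zero) u
  Unique-concatBlocks⁻ Q u (suc i) = Unique-concatBlocks⁻ (Q ∘ suc) (Unique-++⁻ʳ (Q zero) u) i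

  Unique-concatBlocks⇒Disjoint : ∀ {k} (Q : Fin k → List (Fin n)) → Unique (concatBlocks Q) →
    ∀ i j → i ≢ j → Disjoint (Q i) (Q j)
  Unique-concatBlocks⇒Disjoint Q u zero    zero    0≢0 = ⊥-elim (0≢0 refl)
  Unique-concatBlocks⇒Disjoint Q u zero    (suc j) _   (v∈Q₀ , v∈Qⱼ) =
    Unique-++⇒Disjoint (Q zero) u (v∈Q₀ , ∈-concat⁺′ v∈Qⱼ (∈-tabulate⁺ j))
  Unique-concatBlocks⇒Disjoint Q u (suc i) zero    _   (v∈Qᵢ , v∈Q₀) =
    Unique-++⇒Disjoint (Q zero) u (v∈Q₀ , ∈-concat⁺′ v∈Qᵢ (∈-tabulate⁺ i))
  Unique-concatBlocks⇒Disjoint Q u (suc i) (suc j) i≢j =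
    Unique-concatBlocks⇒Disjoint (Q ∘ suc) (Unique-++⁻ʳ (Q zero) u) i j (i≢j ∘ cong suc)

module Orbits {n : ℕ} (f : Fin n → Fin n) where

  orbit : Fin n → ℕ → List (Fin n)
  orbit x zero    = []
  orbit x (suc l) = x ∷ orbit (f x) l

  iter-shift : ∀ t x → iter f t (f x) ≡ f (iter f t x)
  iter-shift zero    x = refl
  iter-shift (suc t) x = cong f (iter-shift t x)

  iter-+ : ∀ t u x → iter f (t + u) x ≡ iter f t (iter f u x)
  iter-+ zero    u x = refl
  iter-+ (suc t) u x = cong f (iter-+ t u x)

  orbitString-suc : ∀ x l → orbitString f x (suc l) ≡ x ∷ orbitString f (f x) l
  orbitString-suc x l = begin
    map (λ t → iter f t x) (upTo (suc l))      ≡⟨ map-upTo (λ t → iter f t x) (suc l) ⟩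
    x ∷ applyUpTo (λ t → iter f (suc t) x) l  ≡⟨ cong (x ∷_) (sym (map-upTo (λ t → iter f (suc t) x) l)) ⟩
    x ∷ map (λ t → iter f (suc t) x) (upTo l)
      ≡⟨ cong (x ∷_) (map-cong (λ t → sym (iter-shift t x)) (upTo l)) ⟩
    x ∷ orbitString f (f x) l                 ∎
    where open ≡-Reasoning

  orbitString≡orbit : ∀ x l → orbitString f x l ≡ orbit x l
  orbitString≡orbit x zero    = refl
  orbitString≡orbit x (suc l) = trans (orbitString-suc x l) (cong (x ∷_) (orbitString≡orbit (f x) l))

  orbit-∷ʳ : ∀ x l → orbit x l ++ [ iter f l x ] ≡ orbit x (suc l)
  orbit-∷ʳ x zero    = refl
  orbit-∷ʳ x (suc l) = cong (x ∷_) (begin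
    orbit (f x) l ++ [ f (iter f l x) ]  ≡⟨ cong (λ y → orbit (f x) l ++ [ y ]) (iter-shift l x) ⟨
    orbit (f x) l ++ [ iter f l (f x) ]  ≡⟨ orbit-∷ʳ (f x) l ⟩
    orbit (f x) (suc l)                  ∎)
    where open ≡-Reasoning

  ∈-orbit : ∀ x {l t} → t < l → iter f t x ∈ orbit x l
  ∈-orbit x {suc l} {zero}  _           = here refl
  ∈-orbit x {suc l} {suc t} (s≤s t<l) = there (subst (_∈ orbit (f x) l) (iter-shift t x) (∈-orbit (f x) t<l))

module Breaks {n : ℕ} (f : Fin n → Fin n) where
  open Orbits f

  gap : Fin n → Fin n → ℕ
  gap x y = mismatch y (f x)

  breaks : List (Fin n) → ℕ
  breaks []           = 0
  breaks (x ∷ [])     = 0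
  breaks (x ∷ y ∷ ys) = gap x y + breaks (y ∷ ys)

  junction : List (Fin n) → List (Fin n) → ℕ
  junction []           _       = 0
  junction (x ∷ [])     []      = 0
  junction (x ∷ [])     (y ∷ _) = gap x y
  junction (x ∷ y ∷ xs) C       = junction (y ∷ xs) C

  cyclicBreaks : List (Fin n) → ℕ
  cyclicBreaks xs = breaks (xs ++ take 1 xs)

  breaks-++ : ∀ A C → breaks (A ++ C) ≡ breaks A + junction A C + breaks C
  breaks-++ []           C       = refl
  breaks-++ (x ∷ [])     []      = refl
  breaks-++ (x ∷ [])     (y ∷ C) = refl
  breaks-++ (x ∷ y ∷ A)  C       = begin
    gap x y + breaks (y ∷ A ++ C)                                   ≡⟨ cong (gap x y +_) (breaks-++ (y ∷ A) C) ⟩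
    gap x y + (breaks (y ∷ A) + junction (y ∷ A) C + breaks C)      ≡⟨ ℕ.+-assoc (gap x y) _ _ ⟨
    gap x y + (breaks (y ∷ A) + junction (y ∷ A) C) + breaks C
      ≡⟨ cong (_+ breaks C) (ℕ.+-assoc (gap x y) _ _) ⟨
    gap x y + breaks (y ∷ A) + junction (y ∷ A) C + breaks C        ∎
    where open ≡-Reasoning

  breaks-++-chains : ∀ A B → breaks A ≡ 0 → breaks B ≡ 0 → breaks (A ++ B) ≡ junction A B
  breaks-++-chains A B chainA chainB = begin
    breaks (A ++ B)                    ≡⟨ breaks-++ A B ⟩
    breaks A + junction A B + breaks B ≡⟨ cong₂ (λ a b → a + junction A B + b) chainA chainB ⟩
    junction A B + 0                   ≡⟨ ℕ.+-identityʳ _ ⟩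
    junction A B                       ∎
    where open ≡-Reasoning

  junction-++ˡ : ∀ A {B C} → B ≢ [] → junction (A ++ B) C ≡ junction B C
  junction-++ˡ []                   B≢[] = refl
  junction-++ˡ (x ∷ [])    {[]}    B≢[] = ⊥-elim (B≢[] refl)
  junction-++ˡ (x ∷ [])    {_ ∷ _} B≢[] = refl
  junction-++ˡ (x ∷ y ∷ A)         B≢[] = junction-++ˡ (y ∷ A) B≢[]

  junction-++ʳ : ∀ A {B} C → B ≢ [] → junction A (B ++ C) ≡ junction A B
  junction-++ʳ []           C B≢[] = refl
  junction-++ʳ (x ∷ [])     {[]}    C B≢[] = ⊥-elim (B≢[] refl)
  junction-++ʳ (x ∷ [])     {_ ∷ _} C B≢[] = refl
  junction-++ʳ (x ∷ y ∷ A)  C B≢[] = junction-++ʳ (y ∷ A) C B≢[]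

  junction≡0⊎1 : ∀ A C → junction A C ≡ 0 ⊎ junction A C ≡ 1
  junction≡0⊎1 []           C       = inj₁ refl
  junction≡0⊎1 (x ∷ [])     []      = inj₁ refl
  junction≡0⊎1 (x ∷ [])     (y ∷ C) = mismatch≡0⊎1
  junction≡0⊎1 (x ∷ y ∷ A)  C       = junction≡0⊎1 (y ∷ A) C

  cyclicBreaks-++ : ∀ A B → A ≢ [] → B ≢ [] →
    cyclicBreaks (A ++ B) ≡ (breaks A + junction A B) + (breaks B + junction B A)
  cyclicBreaks-++ []          B A≢[] B≢[] = ⊥-elim (A≢[] refl)
  cyclicBreaks-++ A@(a ∷ A′) B A≢[] B≢[] = begin
    breaks ((A ++ B) ++ [ a ])                               ≡⟨ cong breaks (++-assoc A B [ a ]) ⟩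
    breaks (A ++ B ++ [ a ])                                 ≡⟨ breaks-++ A (B ++ [ a ]) ⟩
    breaks A + junction A (B ++ [ a ]) + breaks (B ++ [ a ])
      ≡⟨ cong₂ (λ j c → breaks A + j + c) (junction-++ʳ A [ a ] B≢[]) (breaks-++ B [ a ]) ⟩
    breaks A + junction A B + (breaks B + junction B [ a ] + 0)
      ≡⟨ cong (λ c → breaks A + junction A B + c) (ℕ.+-identityʳ _) ⟩
    breaks A + junction A B + (breaks B + junction B [ a ])
      ≡⟨ cong (λ j → breaks A + junction A B + (breaks B + j)) (junction-++ʳ B A′ (λ ())) ⟨
    breaks A + junction A B + (breaks B + junction B A)      ∎
    where open ≡-Reasoning

  cyclicBreaks-swap : ∀ A B → cyclicBreaks (A ++ B) ≡ cyclicBreaks (B ++ A)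
  cyclicBreaks-swap []          B           = cong cyclicBreaks (sym (++-identityʳ B))
  cyclicBreaks-swap A@(_ ∷ _)   []          = cong cyclicBreaks (++-identityʳ A)
  cyclicBreaks-swap A@(_ ∷ _)   B@(_ ∷ _)   = begin
    cyclicBreaks (A ++ B)                                    ≡⟨ cyclicBreaks-++ A B (λ ()) (λ ()) ⟩
    (breaks A + junction A B) + (breaks B + junction B A)    ≡⟨ ℕ.+-comm (breaks A + junction A B) _ ⟩
    (breaks B + junction B A) + (breaks A + junction A B)    ≡⟨ cyclicBreaks-++ B A (λ ()) (λ ()) ⟨
    cyclicBreaks (B ++ A)                                    ∎
    where open ≡-Reasoning

  cyclicBreaks-rotate : ∀ s L → cyclicBreaks (drop s L ++ take s L) ≡ cyclicBreaks L
  cyclicBreaks-rotate s L = trans (cyclicBreaks-swap (drop s L) (take s L)) (cong cyclicBreaks (take++drop≡id s L))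

  breaks-orbit : ∀ x l → breaks (orbit x l) ≡ 0
  breaks-orbit x zero          = refl
  breaks-orbit x (suc zero)    = refl
  breaks-orbit x (suc (suc l)) = cong₂ _+_ (mismatch-≡ refl) (breaks-orbit (f x) (suc l))

  breaks≡0⇒orbit : ∀ x xs → breaks (x ∷ xs) ≡ 0 → x ∷ xs ≡ orbit x (suc (length xs))
  breaks≡0⇒orbit x []       _ = refl
  breaks≡0⇒orbit x (y ∷ ys) b≡0 with mismatch≡0⇒≡ (ℕ.m+n≡0⇒m≡0 (gap x y) b≡0)
  ... | refl = cong (x ∷_) (breaks≡0⇒orbit y ys (ℕ.m+n≡0⇒n≡0 (gap x y) b≡0))

  junction-orbit : ∀ x t y C → junction (orbit x (suc t)) (y ∷ C) ≡ gap (iter f t x) y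
  junction-orbit x zero    y C = refl
  junction-orbit x (suc t) y C = trans (junction-orbit (f x) t y C) (cong (λ z → gap z y) (iter-shift t x))

  junction≡1⇒≢[]ˡ : ∀ A C → junction A C ≡ 1 → A ≢ []
  junction≡1⇒≢[]ˡ [] C () refl

  junction≡1⇒≢[]ʳ : ∀ A C → junction A C ≡ 1 → C ≢ []
  junction≡1⇒≢[]ʳ []          [] () refl
  junction≡1⇒≢[]ʳ (x ∷ [])    [] () refl
  junction≡1⇒≢[]ʳ (x ∷ y ∷ A) [] j≡1 refl = junction≡1⇒≢[]ʳ (y ∷ A) [] j≡1 refl

  junction-take-1 : ∀ A C → junction A (take 1 C) ≡ junction A C
  junction-take-1 A []      = refl
  junction-take-1 A (c ∷ C) = sym (junction-++ʳ A C (λ ()))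

  breaks-take-1 : ∀ L → breaks (take 1 L) ≡ 0
  breaks-take-1 []      = refl
  breaks-take-1 (_ ∷ _) = refl

  wrapJunction : List (Fin n) → ℕ
  wrapJunction xs = junction xs (take 1 xs)

  wrapJunction-++ : ∀ D T → D ≢ [] → T ≢ [] → wrapJunction (D ++ T) ≡ junction T D
  wrapJunction-++ []      T D≢[] T≢[] = ⊥-elim (D≢[] refl)
  wrapJunction-++ (d ∷ D) T D≢[] T≢[] = trans (junction-++ˡ (d ∷ D) T≢[]) (sym (junction-++ʳ T D (λ ())))

  BreakAt : List (Fin n) → ℕ → Set
  BreakAt L s = s ≤ length L × junction (take s L) (drop s L) ≡ 1

  breaks≢0⇒∃BreakAt : ∀ L → breaks L ≢ 0 → ∃ (BreakAt L)
  breaks≢0⇒∃BreakAt []           b≢0 = ⊥-elim (b≢0 refl)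
  breaks≢0⇒∃BreakAt (x ∷ [])     b≢0 = ⊥-elim (b≢0 refl)
  breaks≢0⇒∃BreakAt (x ∷ y ∷ ys) b≢0 =
    extend (mismatch≡0⊎1 {x = y} {f x}) (breaks≢0⇒∃BreakAt (y ∷ ys))
    where
    extend : gap x y ≡ 0 ⊎ gap x y ≡ 1 → (breaks (y ∷ ys) ≢ 0 → ∃ (BreakAt (y ∷ ys))) →
      ∃ (BreakAt (x ∷ y ∷ ys))
    extend (inj₂ gap≡1) _   = 1 , s≤s z≤n , gap≡1
    extend (inj₁ gap≡0) rec with rec (λ b≡0 → b≢0 (cong₂ _+_ gap≡0 b≡0))
    ... | s , s≤ , j≡1 =
      suc s , s≤s s≤ , trans (junction-++ˡ [ x ] (junction≡1⇒≢[]ˡ (take s (y ∷ ys)) _ j≡1)) j≡1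

  cyclicBreaks≢0⇒rotateToBreak : ∀ L → cyclicBreaks L ≢ 0 →
    ∃ λ s → s ≤ length L × wrapJunction (drop s L ++ take s L) ≡ 1
  cyclicBreaks≢0⇒rotateToBreak []          c≢0 = ⊥-elim (c≢0 refl)
  cyclicBreaks≢0⇒rotateToBreak L@(x ∷ xs) c≢0 with junction≡0⊎1 L [ x ]
  ... | inj₂ j≡1 = 0 , z≤n , trans (cong (λ R → junction R [ x ]) (++-identityʳ L)) j≡1
  ... | inj₁ j≡0 with breaks≢0⇒∃BreakAt L breaks≢0
    where
    breaks≢0 : breaks L ≢ 0
    breaks≢0 b≡0 = c≢0 (trans (breaks-++ L [ x ]) (cong₂ (λ b j → b + j + 0) b≡0 j≡0))
  ...   | s , s≤ , j≡1 =
    s , s≤ , trans (wrapJunction-++ D T (junction≡1⇒≢[]ʳ T D j≡1) (junction≡1⇒≢[]ˡ T D j≡1)) j≡1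
    where
    T = take s L
    D = drop s L

module ChainCycles {n : ℕ} (f : Fin n → Fin n) where
  open Breaks f

  record IsChainSequence {r} (Q : Fin (suc r) → List (Fin n)) : Set where
    field
      nonempty : ∀ i → Q i ≢ []
      chain    : ∀ i → breaks (Q i) ≡ 0
      broken   : ∀ j → junction (Q (inject₁ j)) (Q (suc j)) ≡ 1

  record IsChainCycle {r} (Q : Fin (suc r) → List (Fin n)) : Set where
    field
      nonempty : ∀ i → Q i ≢ []
      chain    : ∀ i → breaks (Q i) ≡ 0
      broken   : ∀ i → junction (Q i) (Q (next i)) ≡ 1

    isChainSequence : IsChainSequence Q
    isChainSequence = record
      { nonempty = nonempty
      ; chain    = chain
      ; broken   = λ j → subst (λ i → junction (Q (inject₁ j)) (Q i) ≡ 1) (next-inject₁ j) (broken (inject₁ j))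
      }

  closeChainSequence : ∀ {r} {Q : Fin (suc r) → List (Fin n)} →
    IsChainSequence Q → junction (Q (fromℕ r)) (Q zero) ≡ 1 → IsChainCycle Q
  closeChainSequence {Q = Q} seq closing = record
    { nonempty = nonempty
    ; chain    = chain
    ; broken   = next-elim (λ i j → junction (Q i) (Q j) ≡ 1) broken closing
    }
    where open IsChainSequence seq

  concatBlocks≢[] : ∀ {r} (Q : Fin (suc r) → List (Fin n)) → Q zero ≢ [] → concatBlocks Q ≢ []
  concatBlocks≢[] Q Q₀≢[] eq = Q₀≢[] (List.++-conicalˡ (Q zero) _ eq)

  junction-concatBlocks : ∀ {r} (Q : Fin (suc r) → List (Fin n)) C → (∀ i → Q i ≢ []) →
    junction (concatBlocks Q) C ≡ junction (Q (fromℕ r)) C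
  junction-concatBlocks {zero}  Q C nonempty = cong (λ B → junction B C) (++-identityʳ (Q zero))
  junction-concatBlocks {suc r} Q C nonempty = trans
    (junction-++ˡ (Q zero) (concatBlocks≢[] (Q ∘ suc) (nonempty (suc zero))))
    (junction-concatBlocks (Q ∘ suc) C (λ i → nonempty (suc i)))

  breaks-concatBlocks-++ : ∀ {r} {Q : Fin (suc r) → List (Fin n)} C → IsChainSequence Q →
    junction (Q (fromℕ r)) C ≡ 1 → breaks (concatBlocks Q ++ C) ≡ suc r + breaks C
  breaks-concatBlocks-++ {zero} {Q} C seq last = begin
    breaks ((Q zero ++ []) ++ C)                      ≡⟨ cong (λ B → breaks (B ++ C)) (++-identityʳ (Q zero)) ⟩
    breaks (Q zero ++ C)                              ≡⟨ breaks-++ (Q zero) C ⟩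
    breaks (Q zero) + junction (Q zero) C + breaks C  ≡⟨ cong₂ (λ b j → b + j + breaks C) (chain zero) last ⟩
    1 + breaks C                                      ∎
    where
    open ≡-Reasoning
    open IsChainSequence seq
  breaks-concatBlocks-++ {suc r} {Q} C seq last = begin
    breaks ((Q zero ++ Rest) ++ C)                               ≡⟨ cong breaks (++-assoc (Q zero) Rest C) ⟩
    breaks (Q zero ++ Rest ++ C)                                 ≡⟨ breaks-++ (Q zero) (Rest ++ C) ⟩
    breaks (Q zero) + junction (Q zero) (Rest ++ C) + breaks (Rest ++ C)
      ≡⟨ cong₂ (λ b j → b + j + breaks (Rest ++ C)) (chain zero) junction≡1 ⟩
    1 + breaks (Rest ++ C)                                       ≡⟨ cong suc (breaks-concatBlocks-++ C tail last) ⟩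
    suc (suc r) + breaks C                                       ∎
    where
    open ≡-Reasoning
    open IsChainSequence seq
    Rest = concatBlocks (Q ∘ suc)
    tail : IsChainSequence (Q ∘ suc)
    tail = record
      { nonempty = λ i → nonempty (suc i) ; chain = λ i → chain (suc i) ; broken = λ j → broken (suc j) }
    junction≡1 : junction (Q zero) (Rest ++ C) ≡ 1
    junction≡1 = begin
      junction (Q zero) (Rest ++ C)
        ≡⟨ junction-++ʳ (Q zero) C (concatBlocks≢[] (Q ∘ suc) (nonempty (suc zero))) ⟩
      junction (Q zero) Rest         ≡⟨ junction-++ʳ (Q zero) _ (nonempty (suc zero)) ⟩
      junction (Q zero) (Q (suc zero)) ≡⟨ broken zero ⟩
      1                              ∎

  cyclicBreaks-concatBlocks : ∀ {r} {Q : Fin (suc r) → List (Fin n)} →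
    IsChainCycle Q → cyclicBreaks (concatBlocks Q) ≡ suc r
  cyclicBreaks-concatBlocks {r} {Q} cyc = begin
    breaks (concatBlocks Q ++ H) ≡⟨ breaks-concatBlocks-++ H isChainSequence closing ⟩
    suc r + breaks H             ≡⟨ cong (suc r +_) (breaks-take-1 (concatBlocks Q)) ⟩
    suc r + 0                    ≡⟨ ℕ.+-identityʳ (suc r) ⟩
    suc r                        ∎
    where
    open ≡-Reasoning
    open IsChainCycle cyc
    H = take 1 (concatBlocks Q)
    closing : junction (Q (fromℕ r)) H ≡ 1
    closing = begin
      junction (Q (fromℕ r)) H                ≡⟨ junction-take-1 (Q (fromℕ r)) (concatBlocks Q) ⟩
      junction (Q (fromℕ r)) (concatBlocks Q) ≡⟨ junction-++ʳ (Q (fromℕ r)) _ (nonempty zero) ⟩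
      junction (Q (fromℕ r)) (Q zero)         ≡⟨ cong (λ i → junction (Q (fromℕ r)) (Q i)) (next-fromℕ r) ⟨
      junction (Q (fromℕ r)) (Q (next (fromℕ r))) ≡⟨ broken (fromℕ r) ⟩
      1                                       ∎

  record ChainDecomposition (L : List (Fin n)) : Set where
    field
      r               : ℕ
      blocks          : Fin (suc r) → List (Fin n)
      concat≡         : concatBlocks blocks ≡ L
      isChainSequence : IsChainSequence blocks

    open IsChainSequence isChainSequence public

    junction-first : ∀ A → junction A (blocks zero) ≡ junction A L
    junction-first A = trans (sym (junction-++ʳ A _ (nonempty zero))) (cong (junction A) concat≡)

  extendDecomposition : ∀ x {y ys} → gap x y ≡ 0 ⊎ gap x y ≡ 1 →
    ChainDecomposition (y ∷ ys) → ChainDecomposition (x ∷ y ∷ ys)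
  extendDecomposition x (inj₁ gap≡0) D = record
    { r = r ; blocks = Q′ ; concat≡ = cong (x ∷_) concat≡
    ; isChainSequence = record { nonempty = nonempty′ ; chain = chain′ ; broken = broken′ }
    }
    where
    open ChainDecomposition D
    Q′ : Fin (suc r) → List (Fin n)
    Q′ zero    = x ∷ blocks zero
    Q′ (suc i) = blocks (suc i)
    nonempty′ : ∀ i → Q′ i ≢ []
    nonempty′ zero    = λ ()
    nonempty′ (suc i) = nonempty (suc i)
    chain′ : ∀ i → breaks (Q′ i) ≡ 0
    chain′ zero    = trans (breaks-++ [ x ] (blocks zero))
                           (cong₂ _+_ (trans (junction-first [ x ]) gap≡0) (chain zero))
    chain′ (suc i) = chain (suc i)
    broken′ : ∀ j → junction (Q′ (inject₁ j)) (Q′ (suc j)) ≡ 1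
    broken′ zero    = trans (junction-++ˡ [ x ] (nonempty zero)) (broken zero)
    broken′ (suc j) = broken (suc j)
  extendDecomposition x (inj₂ gap≡1) D = record
    { r = suc r ; blocks = Q′ ; concat≡ = cong (x ∷_) concat≡
    ; isChainSequence = record { nonempty = nonempty′ ; chain = chain′ ; broken = broken′ }
    }
    where
    open ChainDecomposition D
    Q′ : Fin (suc (suc r)) → List (Fin n)
    Q′ zero    = [ x ]
    Q′ (suc i) = blocks i
    nonempty′ : ∀ i → Q′ i ≢ []
    nonempty′ zero    = λ ()
    nonempty′ (suc i) = nonempty i
    chain′ : ∀ i → breaks (Q′ i) ≡ 0
    chain′ zero    = refl
    chain′ (suc i) = chain i
    broken′ : ∀ j → junction (Q′ (inject₁ j)) (Q′ (suc j)) ≡ 1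
    broken′ zero    = trans (junction-first [ x ]) gap≡1
    broken′ (suc j) = broken j

  chainDecomposition : ∀ x xs → ChainDecomposition (x ∷ xs)
  chainDecomposition x []       = record
    { r = 0 ; blocks = λ _ → [ x ] ; concat≡ = refl
    ; isChainSequence = record { nonempty = λ _ () ; chain = λ _ → refl ; broken = λ () }
    }
  chainDecomposition x (y ∷ ys) = extendDecomposition x mismatch≡0⊎1 (chainDecomposition y ys)

  wrapJunction≡1⇒chainCycle : ∀ R → wrapJunction R ≡ 1 →
    Σ ℕ λ r → Σ (Fin (suc r) → List (Fin n)) λ Q → concatBlocks Q ≡ R × IsChainCycle Q
  wrapJunction≡1⇒chainCycle []         ()
  wrapJunction≡1⇒chainCycle R@(x ∷ xs) wrap≡1 = r , blocks , concat≡ , closeChainSequence isChainSequence closing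
    where
    open ChainDecomposition (chainDecomposition x xs)
    open ≡-Reasoning
    closing : junction (blocks (fromℕ r)) (blocks zero) ≡ 1
    closing = begin
      junction (blocks (fromℕ r)) (blocks zero)    ≡⟨ junction-first (blocks (fromℕ r)) ⟩
      junction (blocks (fromℕ r)) R                ≡⟨ junction-take-1 (blocks (fromℕ r)) R ⟨
      junction (blocks (fromℕ r)) (take 1 R)       ≡⟨ junction-concatBlocks blocks (take 1 R) nonempty ⟨
      junction (concatBlocks blocks) (take 1 R)    ≡⟨ cong (λ B → junction B (take 1 R)) concat≡ ⟩
      junction R (take 1 R)                        ≡⟨ wrap≡1 ⟩
      1                                            ∎

module Blocks {n : ℕ} (β : Permutation′ n) where
  private
    f : Fin n → Fin n
    f = β ⟨$⟩ʳ_
  open Orbits f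
  open Breaks f
  open ChainCycles f

  iter-≡⇒periodic : ∀ {x} i j → i < j → iter f i x ≡ iter f j x → iter f (j ∸ i) x ≡ x
  iter-≡⇒periodic {x} i j i<j eq = iter-injective i (begin
    iter f i (iter f (j ∸ i) x) ≡⟨ iter-+ i (j ∸ i) x ⟨
    iter f (i + (j ∸ i)) x      ≡⟨ cong (λ t → iter f t x) (ℕ.m+[n∸m]≡n (ℕ.<⇒≤ i<j)) ⟩
    iter f j x                  ≡⟨ eq ⟨
    iter f i x                  ∎)
    where
    open ≡-Reasoning
    iter-injective : ∀ t {x y} → iter f t x ≡ iter f t y → x ≡ y
    iter-injective zero    eq = eq
    iter-injective (suc t) eq = iter-injective t (Injection.injective (↔⇒↣ β) eq)

  cycleLength-exists : ∀ c → ∃ (IsCycleLength β c)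
  cycleLength-exists c with pigeonhole (ℕ.n<1+n n) (λ i → iter f (toℕ i) c)
  ... | i , j , i<j , eq = leastPositive-exists (λ t → iter f t c ≟ c)
          (toℕ j ∸ toℕ i) (ℕ.m<n⇒0<n∸m i<j) (iter-≡⇒periodic (toℕ i) (toℕ j) i<j eq)

  Unique-orbit⇒≤ : ∀ {c m l} → IsCycleLength β c m → Unique (orbit c l) → l ≤ m
  Unique-orbit⇒≤ {c} (1≤m , iterₘ≡c , _) u = ℕ.≮⇒≥ (λ m<l → repeat 1≤m m<l iterₘ≡c u)
    where
    repeat : ∀ {m l} → 1 ≤ m → m < l → iter f m c ≡ c → ¬ Unique (orbit c l)
    repeat {suc m} {suc l} _ (s≤s m<l) iterₘ≡c u =
      Unique.Unique[x∷xs]⇒x∉xs u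
        (subst (_∈ orbit (f c) l) (trans (iter-shift m c) iterₘ≡c) (∈-orbit (f c) m<l))

  Unique-cycleString : ∀ {c m} → IsCycleLength β c m → Unique (cycleString β c m)
  Unique-cycleString {c} {m} (_ , _ , minimal) = subst Unique (sym (map-upTo (λ t → iter f t c) m))
    (Unique.applyUpTo⁺₁ (λ t → iter f t c) m λ {i} {j} i<j j<m iᵢ≡iⱼ →
      minimal (j ∸ i) (ℕ.m<n⇒0<n∸m i<j) (ℕ.≤-<-trans (ℕ.m∸n≤m j i) j<m)
        (iter-≡⇒periodic i j i<j iᵢ≡iⱼ))

  chain⇒orbitString : ∀ x xs → breaks (x ∷ xs) ≡ 0 → Unique (x ∷ xs) → ∀ {m} → IsCycleLength β x m →
    length (x ∷ xs) ≤ m × x ∷ xs ≡ orbitString f x (length (x ∷ xs))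
  chain⇒orbitString x xs chain u cl =
    Unique-orbit⇒≤ cl (subst Unique xs≡orbit u) , trans xs≡orbit (sym (orbitString≡orbit x _))
    where
    xs≡orbit = breaks≡0⇒orbit x xs chain

  chain⇒block : ∀ xs → xs ≢ [] → breaks xs ≡ 0 → Unique xs → IsBlock β xs
  chain⇒block []       xs≢[] = ⊥-elim (xs≢[] refl)
  chain⇒block (x ∷ xs) _ chain u with cycleLength-exists x
  ... | m , cl = x , m , length (x ∷ xs) , cl , s≤s z≤n , chain⇒orbitString x xs chain u cl

  chain⇒properBlock : ∀ xs → xs ≢ [] → breaks xs ≡ 0 → Unique xs → junction xs xs ≡ 1 →
    IsProperBlock β xs
  chain⇒properBlock []       xs≢[] = ⊥-elim (xs≢[] refl)
  chain⇒properBlock (x ∷ xs) _ chain u wrap≡1 with cycleLength-exists x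
  ... | m , cl@(_ , iterₘ≡x , _) with chain⇒orbitString x xs chain u cl
  ...   | l≤m , xs≡ = x , m , length (x ∷ xs) , cl , s≤s z≤n , ℕ.≤∧≢⇒< l≤m l≢m , xs≡
    where
    l≢m : length (x ∷ xs) ≢ m
    l≢m refl = ℕ.1+n≢0 (begin
      1                                              ≡⟨ wrap≡1 ⟨
      junction (x ∷ xs) (x ∷ xs)                     ≡⟨ cong (λ ys → junction ys ys) (breaks≡0⇒orbit x xs chain) ⟩
      junction (orbit x (suc (length xs))) (orbit x (suc (length xs))) ≡⟨ junction-orbit x (length xs) x _ ⟩
      mismatch x (iter f (suc (length xs)) x)        ≡⟨ mismatch-≡ (sym iterₘ≡x) ⟩
      0                                              ∎)
      where open ≡-Reasoning

  block⇒≢[] : ∀ {xs} → IsBlock β xs → xs ≢ []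
  block⇒≢[] (c , m , suc l , _ , _ , _ , xs≡) refl with trans xs≡ (orbitString-suc c l)
  ... | ()

  block⇒chain : ∀ {xs} → IsBlock β xs → breaks xs ≡ 0
  block⇒chain (c , m , l , _ , _ , _ , xs≡) =
    trans (cong breaks (trans xs≡ (orbitString≡orbit c l))) (breaks-orbit c l)

  properBlock⇒block : ∀ {xs} → IsProperBlock β xs → IsBlock β xs
  properBlock⇒block (c , m , l , cl , 1≤l , l<m , xs≡) = c , m , l , cl , 1≤l , ℕ.<⇒≤ l<m , xs≡

  properBlock⇒junction : ∀ {xs} → IsProperBlock β xs → junction xs xs ≡ 1
  properBlock⇒junction {xs} (c , m , suc l , (_ , _ , minimal) , _ , l<m , xs≡) = begin
    junction xs xs
      ≡⟨ cong (λ ys → junction ys ys) (trans xs≡ (orbitString≡orbit c (suc l))) ⟩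
    junction (orbit c (suc l)) (orbit c (suc l))   ≡⟨ junction-orbit c l c _ ⟩
    mismatch c (iter f (suc l) c)                  ≡⟨ mismatch-≢ (λ c≡ → minimal (suc l) (s≤s z≤n) l<m (sym c≡)) ⟩
    1                                              ∎
    where open ≡-Reasoning

  chainCycle⇒blockConditions : ∀ {r} {Q : Fin (suc r) → List (Fin n)} →
    Unique (concatBlocks Q) → IsChainCycle Q → BlockConditions β (suc r) Q
  chainCycle⇒blockConditions {zero} {Q} u cyc =
    (λ _ → λ { zero → chain⇒properBlock (Q zero) (nonempty zero) (chain zero)
                                         (Unique-concatBlocks⁻ Q u zero) (broken zero) }) ,
    λ { (s≤s ()) }
    where open IsChainCycle cyc
  chainCycle⇒blockConditions {suc r} {Q} u cyc = (λ ()) , λ _ → isBlock , disjoint , notBlock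
    where
    open IsChainCycle cyc
    isBlock : ∀ i → IsBlock β (Q i)
    isBlock i = chain⇒block (Q i) (nonempty i) (chain i) (Unique-concatBlocks⁻ Q u i)
    disjoint : PairwiseDisjoint Q
    disjoint i j i≢j x x∈Qᵢ x∈Qⱼ = Unique-concatBlocks⇒Disjoint Q u i j i≢j (x∈Qᵢ , x∈Qⱼ)
    notBlock : ∀ i → ¬ IsBlock β (Q i ++ Q (next i))
    notBlock i isBlock = ℕ.1+n≢0 (begin
      1                                 ≡⟨ broken i ⟨
      junction (Q i) (Q (next i))       ≡⟨ breaks-++-chains (Q i) (Q (next i)) (chain i) (chain (next i)) ⟨
      breaks (Q i ++ Q (next i))        ≡⟨ block⇒chain isBlock ⟩
      0                                 ∎)
      where open ≡-Reasoning

  blockConditions⇒chainCycle : ∀ {r} {Q : Fin (suc r) → List (Fin n)} →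
    Unique (concatBlocks Q) → BlockConditions β (suc r) Q → IsChainCycle Q
  blockConditions⇒chainCycle {zero} {Q} u (proper , _) = record
    { nonempty = λ { zero → block⇒≢[] (properBlock⇒block (proper refl zero)) }
    ; chain    = λ { zero → block⇒chain (properBlock⇒block (proper refl zero)) }
    ; broken   = λ { zero → properBlock⇒junction (proper refl zero) }
    }
  blockConditions⇒chainCycle {suc r} {Q} u (_ , conditions) = record
    { nonempty = λ i → block⇒≢[] (isBlock i)
    ; chain    = λ i → block⇒chain (isBlock i)
    ; broken   = broken
    }
    where
    isBlock = proj₁ (conditions (s≤s (s≤s z≤n)))
    notBlock = proj₂ (proj₂ (conditions (s≤s (s≤s z≤n))))
    broken : ∀ i → junction (Q i) (Q (next i)) ≡ 1
    broken i with junction≡0⊎1 (Q i) (Q (next i))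
    ... | inj₂ j≡1 = j≡1
    ... | inj₁ j≡0 = ⊥-elim (notBlock i (chain⇒block (Q i ++ Q (next i)) nonempty chain unique))
      where
      nonempty : Q i ++ Q (next i) ≢ []
      nonempty eq = block⇒≢[] (isBlock i) (List.++-conicalˡ (Q i) _ eq)
      chain : breaks (Q i ++ Q (next i)) ≡ 0
      chain = trans (breaks-++-chains (Q i) (Q (next i)) (block⇒chain (isBlock i)) (block⇒chain (isBlock (next i))))
                    j≡0
      unique : Unique (Q i ++ Q (next i))
      unique = Unique.++⁺ (Unique-concatBlocks⁻ Q u i) (Unique-concatBlocks⁻ Q u (next i))
                          (Unique-concatBlocks⇒Disjoint Q u i (next i) (≢-next i))

  cyclicBreaks⇒blockConditions : ∀ {k} L → Unique L → 1 ≤ k → cyclicBreaks L ≡ k →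
    Σ (Fin k → List (Fin n)) λ P → IsRotationOf (concatBlocks P) L × BlockConditions β k P
  cyclicBreaks⇒blockConditions {k} L u 1≤k cyclic≡k
    with cyclicBreaks≢0⇒rotateToBreak L (λ cyclic≡0 → ℕ.<⇒≢ 1≤k (trans (sym cyclic≡0) cyclic≡k))
  ... | s , s≤ , wrap≡1 with wrapJunction≡1⇒chainCycle (drop s L ++ take s L) wrap≡1
  ...   | r , Q , concat≡ , cyc with begin
          suc r                                      ≡⟨ cyclicBreaks-concatBlocks cyc ⟨
          cyclicBreaks (concatBlocks Q)              ≡⟨ cong cyclicBreaks concat≡ ⟩
          cyclicBreaks (drop s L ++ take s L)        ≡⟨ cyclicBreaks-rotate s L ⟩
          cyclicBreaks L                             ≡⟨ cyclic≡k ⟩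
          k                                          ∎
    where open ≡-Reasoning
  ...     | refl =
    Q , (s , s≤ , concat≡) , chainCycle⇒blockConditions (subst Unique (sym concat≡) (Unique-rotate s L u)) cyc

  rotationOfBlocks⇒cyclicBreaks : ∀ {k} L (P : Fin k → List (Fin n)) → Unique L → 1 ≤ k →
    IsRotationOf (concatBlocks P) L → BlockConditions β k P → cyclicBreaks L ≡ k
  rotationOfBlocks⇒cyclicBreaks {suc r} L P u _ (s , _ , P≡) conditions = begin
    cyclicBreaks L                       ≡⟨ cyclicBreaks-rotate s L ⟨
    cyclicBreaks (drop s L ++ take s L)  ≡⟨ cong cyclicBreaks P≡ ⟨
    cyclicBreaks (concatBlocks P)
      ≡⟨ cyclicBreaks-concatBlocks (blockConditions⇒chainCycle uniqueP conditions) ⟩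
    suc r                                ∎
    where
    open ≡-Reasoning
    uniqueP = subst Unique (sym P≡) (Unique-rotate s L u)

module Conjugation {n : ℕ} (α β : Permutation′ n) where
  private
    f : Fin n → Fin n
    f = β ⟨$⟩ʳ_
    α′ : Fin n → Fin n
    α′ = α ⟨$⟩ʳ_
  open Orbits f
  open Breaks f

  badness : Fin n → ℕ
  badness x = mismatch (α′ (f x)) (f (α′ x))

  length-badPoints : ∀ a m → length (badPoints α β a m) ≡ sum (map badness (orbit a m))
  length-badPoints a m = trans (length-filter-≢ (λ x → α′ (f x)) (λ x → f (α′ x)) (cycleString β a m))
                               (cong (λ xs → sum (map badness xs)) (orbitString≡orbit a m))

  iter-conj : ∀ t x → iter (conj α β) t (α′ x) ≡ α′ (iter f t x)
  iter-conj zero    x = refl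
  iter-conj (suc t) x = trans (cong (conj α β) (iter-conj t x)) (cong (λ y → α′ (f y)) (inverseˡ α))

  conjCycleString≡map : ∀ a m → conjCycleString α β a m ≡ map α′ (orbit a m)
  conjCycleString≡map a m = begin
    map (λ t → iter (conj α β) t (α′ a)) (upTo m) ≡⟨ map-cong (λ t → iter-conj t a) (upTo m) ⟩
    map (λ t → α′ (iter f t a)) (upTo m)         ≡⟨ List.map-∘ (upTo m) ⟩
    map α′ (orbitString f a m)                   ≡⟨ cong (map α′) (orbitString≡orbit a m) ⟩
    map α′ (orbit a m)                           ∎
    where open ≡-Reasoning

  -- gap (α′ x) (α′ (f x)) unfolds to badness x.
  breaks-map-orbit : ∀ x l → breaks (map α′ (orbit x (suc l))) ≡ sum (map badness (orbit x l))
  breaks-map-orbit x zero    = refl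
  breaks-map-orbit x (suc l) = cong (badness x +_) (breaks-map-orbit (f x) l)

  cyclicBreaks-map-orbit : ∀ a m → iter f m a ≡ a →
    cyclicBreaks (map α′ (orbit a m)) ≡ sum (map badness (orbit a m))
  cyclicBreaks-map-orbit a zero      _        = refl
  cyclicBreaks-map-orbit a m@(suc _) periodic = begin
    breaks (map α′ (orbit a m) ++ [ α′ a ])        ≡⟨ cong breaks (List.map-++ α′ (orbit a m) [ a ]) ⟨
    breaks (map α′ (orbit a m ++ [ a ]))           ≡⟨ cong (λ y → breaks (map α′ (orbit a m ++ [ y ]))) periodic ⟨
    breaks (map α′ (orbit a m ++ [ iter f m a ]))  ≡⟨ cong (λ xs → breaks (map α′ xs)) (orbit-∷ʳ a m) ⟩
    breaks (map α′ (orbit a (suc m)))              ≡⟨ breaks-map-orbit a m ⟩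
    sum (map badness (orbit a m))                  ∎
    where open ≡-Reasoning

  length-badPoints≡cyclicBreaks : ∀ {a m} → IsCycleLength β a m →
    length (badPoints α β a m) ≡ cyclicBreaks (conjCycleString α β a m)
  length-badPoints≡cyclicBreaks {a} {m} (_ , periodic , _) = begin
    length (badPoints α β a m)              ≡⟨ length-badPoints a m ⟩
    sum (map badness (orbit a m))           ≡⟨ cyclicBreaks-map-orbit a m periodic ⟨
    cyclicBreaks (map α′ (orbit a m))       ≡⟨ cong cyclicBreaks (conjCycleString≡map a m) ⟨
    cyclicBreaks (conjCycleString α β a m)  ∎
    where open ≡-Reasoning

  Unique-conjCycleString : ∀ {a m} → IsCycleLength β a m → Unique (conjCycleString α β a m)
  Unique-conjCycleString {a} {m} cl = subst Unique (sym (conjCycleString≡map a m))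
    (Unique.map⁺ (Injection.injective (↔⇒↣ α))
      (subst Unique (orbitString≡orbit a m) (Blocks.Unique-cycleString β cl)))

theorem2 : ∀ {n} (β : Permutation′ n) (a : Fin n) (m : ℕ) → IsCycleLength β a m →
    (α : Permutation′ n) (k : ℕ) → 1 ≤ k →
    (KBetaCommutes k α β a m ⇔
      Σ (Fin k → List (Fin n)) λ P →
        IsRotationOf (concatBlocks P) (conjCycleString α β a m) × BlockConditions β k P)
theorem2 β a m cl α k 1≤k = mk⇔
  (λ bad≡k → cyclicBreaks⇒blockConditions X uniqueX 1≤k (trans (sym count) bad≡k))
  (λ (P , rotation , conditions) → trans count (rotationOfBlocks⇒cyclicBreaks X P uniqueX 1≤k rotation conditions))
  where
  open Blocks β
  open Conjugation α β
  X = conjCycleString α β a m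
  count = length-badPoints≡cyclicBreaks cl
  uniqueX = Unique-conjCycleString cl
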